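{- Let $F$ be a nonempty graph without isolated vertices and $s$ a positive integer. Then for all sufficiently large $n$, $$\mathrm{ex}_F(n,K_{1,s})=\left\lfloor \frac{n(s-1)}{v(F)}\right\rfloor.$$
   Context: All graphs are simple; $v(F)$ is the number of vertices of $F$ and $K_{1,s}$ is the star with $s$ edges. $\mathrm{ex}_F(n,G)$ is the maximum $k$ such that there exist $k$ pairwise edge-disjoint subgraphs $F_1,\dots,F_k$ of $K_n$, each isomorphic to $F$, such that $\bigcup_i F_i$ contains no subgraph $G'$ isomorphic to $G$ with $|E(G')\cap E(F_i)|\le 1$ for every $i$. -}

module Defs where

open import Data.Nat using (ℕ; _≤_; _+_; _*_; _∸_; suc)
open import Data.Fin using (Fin)
open import Data.Bool using (Bool; true; false)
open import Data.Product using (Σ; ∃; _×_; _,_)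
open import Relation.Binary.PropositionalEquality using (_≡_)
open import Relation.Nullary using (¬_)
open import Function.Definitions using (Injective)

record Graph (m : ℕ) : Set where
  field
    adj   : Fin m → Fin m → Bool
    sym   : ∀ u v → adj u v ≡ adj v u
    irrefl : ∀ u → adj u u ≡ false
open Graph public

-- F is nonempty: it has at least one edge.
HasEdge : ∀ {m} → Graph m → Set
HasEdge F = ∃ λ u → ∃ λ v → adj F u v ≡ true

NoIsolated : ∀ {m} → Graph m → Set
NoIsolated F = ∀ u → ∃ λ v → adj F u v ≡ true

-- A copy of F in K_n: an injective map of the vertices of F into Fin n.
-- Its edge set is the image of E(F).
record Copy {m : ℕ} (F : Graph m) (n : ℕ) : Set where
  field
    emb : Fin m → Fin n
    inj : Injective _≡_ _≡_ emb
open Copy public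

-- The (unordered) edge {a,b} of K_n belongs to the copy φ of F.
InCopy : ∀ {m n} {F : Graph m} → Copy F n → Fin n → Fin n → Set
InCopy {F = F} φ a b =
  ∃ λ u → ∃ λ v → adj F u v ≡ true × emb φ u ≡ a × emb φ v ≡ b

EdgeDisjoint : ∀ {m n k} {F : Graph m} → (Fin k → Copy F n) → Set
EdgeDisjoint {n = n} {k = k} Fs =
  ∀ (i j : Fin k) → ¬ (i ≡ j) → ∀ (a b : Fin n) →
    ¬ (InCopy (Fs i) a b × InCopy (Fs j) a b)

-- A copy of K_{1,s} in the union of the Fs with at most one edge from each F_i:
-- a centre c and s distinct leaves (different from c), each edge c l_j lying
-- in the union, and no F_i containing two of these edges.
RainbowStar : ∀ {m n k} {F : Graph m} → ℕ → (Fin k → Copy F n) → Set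
RainbowStar {n = n} {k = k} s Fs =
  Σ (Fin n) λ c → Σ (Fin s → Fin n) λ l →
    Injective _≡_ _≡_ l ×
    (∀ j → ¬ (l j ≡ c)) ×
    (∀ j → ∃ λ (i : Fin k) → InCopy (Fs i) c (l j)) ×
    (∀ (i : Fin k) (j j' : Fin s) → ¬ (j ≡ j') →
       ¬ (InCopy (Fs i) c (l j) × InCopy (Fs i) c (l j')))

-- A valid family witnessing ex_F(n, K_{1,s}) ≥ k.
Good : ∀ {m} → Graph m → (n s k : ℕ) → Set
Good F n s k = Σ (Fin k → Copy F n) λ Fs → EdgeDisjoint Fs × ¬ RainbowStar s Fs

-- ex_F(n, K_{1,s}) = e : e is the maximum k admitting a good family.
IsExF : ∀ {m} → Graph m → (n s e : ℕ) → Set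
IsExF F n s e = Good F n s e × (∀ k → Good F n s k → k ≤ e)

-- Write r = s − 1 and m = v(F).
-- Upper bound: since F has no isolated vertex, every copy through a vertex c has an edge at c, and
-- these edges are distinct; so a vertex lying in more than r copies is the centre of a forbidden star,
-- and double counting vertex–copy incidences gives k·m ≤ n·r.
-- Lower bound: write n = ρ + m·q with ρ < m and r·m ≤ q. On a grid of m rows and q columns the lines
-- u ↦ (u, a + b·u mod q) with slope b < r meet pairwise in at most one cell (because r·m ≤ q), and
-- through each cell passes exactly one line of each slope. Colouring every incidence by the slope,
-- copies meeting at a vertex in the same colour coincide, so a star taking at most one edge from each
-- copy has at most r edges. This gives q·r copies. The missing E = ⌊ρ·r/m⌋ are obtained by deleting
-- the R = E·(m − 1) horizontal lines with a < R and reusing their cells for E·m patches: one of the ρ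
-- extra points (each in at most r patches, coloured by w mod r) joined to m − 1 cells of a single row
-- (coloured 0, the colour freed by the deletion). In total q·r − R + E·m = q·r + E = ⌊n·r/m⌋.

module Submission where

open import Defs hiding (sym)
open import Data.Nat using (ℕ; zero; suc; _+_; _*_; _∸_; _≤_; _<_; z≤n; s≤s; NonZero; _≤?_; _<?_; >-nonZero; >-nonZero⁻¹)
open import Data.Nat.Properties hiding (suc-injective; 0≢1+n)
open import Data.Nat.DivMod using (_/_; _%_; m≡m%n+[m/n]*n; [m+kn]%n≡m%n; m<n⇒m%n≡m; +-distrib-/-∣ʳ; m<n⇒m/n≡0; m*n/n≡m; m%n<n; m<n*o⇒m/o<n; m/n*n≤m; /-monoˡ-≤; 0/n≡0)
open import Data.Nat.Divisibility using (divides-refl)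
open import Data.Nat.Tactic.RingSolver using (solve-∀)
open import Algebra.Properties.CommutativeSemigroup +-commutativeSemigroup using (xy∙z≈xz∙y; x∙yz≈y∙xz)
open import Algebra.Properties.CommutativeMonoid.Sum +-0-commutativeMonoid
  using (sum; ∑-comm; sum-cong-≗; sum-replicate-zero)
open import Data.Fin using (Fin; zero; suc; toℕ; fromℕ<)
open import Data.Fin.Properties using (suc-injective; 0≢1+n; injective⇒≤; toℕ<n; toℕ-injective; fromℕ<-injective) renaming (_≟_ to _≟ᶠ_)
open import Data.Vec.Functional using (_∷_)
open import Data.Bool using (true)
open import Data.Product using (Σ; ∃; ∃₂; _×_; _,_; proj₁; proj₂)
open import Data.Empty using (⊥-elim)
open import Relation.Nullary using (¬_; yes; no; contradiction)
open import Relation.Binary using (tri<; tri≈; tri>)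
open import Relation.Binary.PropositionalEquality
open import Function using (_∘_; case_of_)
open import Function.Definitions using (Injective)

sum-mono-≤ : ∀ {k} {f g : Fin k → ℕ} → (∀ i → f i ≤ g i) → sum f ≤ sum g
sum-mono-≤ {zero}  f≤g = z≤n
sum-mono-≤ {suc k} f≤g = +-mono-≤ (f≤g zero) (sum-mono-≤ (f≤g ∘ suc))

sum-const : ∀ k c → sum {k} (λ _ → c) ≡ k * c
sum-const zero    c = refl
sum-const (suc k) c = cong (c +_) (sum-const k c)

δ : ∀ {n} → Fin n → Fin n → ℕ
δ zero    zero    = 1
δ zero    (suc _) = 0
δ (suc _) zero    = 0
δ (suc x) (suc y) = δ x y

δ-diag : ∀ {n} (x : Fin n) → δ x x ≡ 1
δ-diag zero    = refl
δ-diag (suc x) = δ-diag x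

δ-≢ : ∀ {n} {x y : Fin n} → ¬ x ≡ y → δ x y ≡ 0
δ-≢ {x = zero}  {zero}  x≢y = contradiction refl x≢y
δ-≢ {x = zero}  {suc y} x≢y = refl
δ-≢ {x = suc x} {zero}  x≢y = refl
δ-≢ {x = suc x} {suc y} x≢y = δ-≢ (x≢y ∘ cong suc)

δ>0⇒≡ : ∀ {n} {x y : Fin n} → 0 < δ x y → x ≡ y
δ>0⇒≡ {x = zero}  {zero}  _ = refl
δ>0⇒≡ {x = suc x} {suc y} p = cong suc (δ>0⇒≡ p)

sum-δ : ∀ {n} (x : Fin n) → sum (δ x) ≡ 1
sum-δ {suc n} zero    = cong suc (sum-replicate-zero n)
sum-δ {suc n} (suc x) = sum-δ x

sum>0⇒∃ : ∀ {k} (g : Fin k → ℕ) → 0 < sum g → ∃ λ i → 0 < g i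
sum>0⇒∃ {suc k} g pos with g zero in g₀≡
... | suc _ = zero , ≤-trans (s≤s z≤n) (≤-reflexive (sym g₀≡))
... | zero  = let i , gᵢ>0 = sum>0⇒∃ (g ∘ suc) pos in suc i , gᵢ>0

sum-δ-injective : ∀ {m n} {f : Fin m → Fin n} → Injective _≡_ _≡_ f → ∀ c → sum (λ u → δ (f u) c) ≤ 1
sum-δ-injective {zero}          _   c = z≤n
sum-δ-injective {suc m} {f = f} inj c with f zero ≟ᶠ c
... | no  f0≢c rewrite δ-≢ f0≢c = sum-δ-injective (suc-injective ∘ inj) c
... | yes refl = ≤-reflexive (begin
  δ (f zero) (f zero) + sum (λ u → δ (f (suc u)) (f zero))  ≡⟨ cong₂ _+_ (δ-diag (f zero)) (sum-cong-≗ {m} (λ u → δ-≢ (0≢1+n ∘ inj ∘ sym))) ⟩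
  1 + sum {m} (λ _ → 0)                                      ≡⟨ cong suc (sum-replicate-zero m) ⟩
  1 ∎)
  where open ≡-Reasoning

sum≥⇒support-injection : ∀ {k} (g : Fin k → ℕ) → (∀ i → g i ≤ 1) → ∀ {s} → s ≤ sum g →
  Σ (Fin s → Fin k) λ p → Injective _≡_ _≡_ p × (∀ j → 0 < g (p j))
sum≥⇒support-injection         g g≤1 {zero}  _ = (λ ()) , (λ { {()} }) , (λ ())
sum≥⇒support-injection {zero}  g g≤1 {suc s} ()
sum≥⇒support-injection {suc k} g g≤1 {suc s} s<sum with g zero in g₀≡ | g≤1 zero
... | zero | _ =
  let p , p-inj , p-pos = sum≥⇒support-injection (g ∘ suc) (g≤1 ∘ suc) s<sum
  in  suc ∘ p , p-inj ∘ suc-injective , p-pos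
... | suc zero | _ =
  let p , p-inj , p-pos = sum≥⇒support-injection (g ∘ suc) (g≤1 ∘ suc) (≤-pred s<sum)
  in  zero ∷ suc ∘ p
    , (λ { {zero} {zero} _ → refl ; {suc i} {suc j} eq → cong suc (p-inj (suc-injective eq)) })
    , (λ { zero → ≤-reflexive (sym g₀≡) ; (suc j) → p-pos j })
... | suc (suc _) | s≤s ()

adj⇒≢ : ∀ {m} (F : Graph m) {u v} → adj F u v ≡ true → ¬ u ≡ v
adj⇒≢ F {u} uv refl with trans (sym uv) (irrefl F u)
... | ()

module Degree {m n k} {F : Graph m} (Fs : Fin k → Copy F n) where

  multiplicity : Fin k → Fin n → ℕ
  multiplicity i c = sum (λ u → δ (emb (Fs i) u) c)

  degree : Fin n → ℕ
  degree c = sum (λ i → multiplicity i c)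

  multiplicity≤1 : ∀ i c → multiplicity i c ≤ 1
  multiplicity≤1 i = sum-δ-injective (inj (Fs i))

  sum-degree : sum degree ≡ k * m
  sum-degree = begin
    sum (λ c → sum (λ i → multiplicity i c))                ≡⟨ ∑-comm (λ i c → multiplicity i c) ⟨
    sum (λ i → sum (λ c → sum (λ u → δ (emb (Fs i) u) c)))  ≡⟨ sum-cong-≗ {k} (λ i → ∑-comm (λ u → δ (emb (Fs i) u))) ⟨
    sum (λ i → sum (λ u → sum (δ (emb (Fs i) u))))          ≡⟨ sum-cong-≗ {k} (λ i → sum-cong-≗ {m} (sum-δ ∘ emb (Fs i))) ⟩
    sum {k} (λ _ → sum {m} (λ _ → 1))                       ≡⟨ sum-cong-≗ {k} (λ _ → trans (sum-const m 1) (*-identityʳ m)) ⟩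
    sum {k} (λ _ → m)                                       ≡⟨ sum-const k m ⟩
    k * m                                                   ∎
    where open ≡-Reasoning

  degree⇒rainbowStar : NoIsolated F → EdgeDisjoint Fs → ∀ {s} c → s ≤ degree c → RainbowStar s Fs
  degree⇒rainbowStar noIsolated disjoint {s} c s≤deg = c , leaf , leaf-inj , leaf≢c , covered , rainbow
    where
    picked = sum≥⇒support-injection (λ i → multiplicity i c) (λ i → multiplicity≤1 i c) s≤deg
    copy : Fin s → Fin k
    copy = proj₁ picked
    copy-inj : Injective _≡_ _≡_ copy
    copy-inj = proj₁ (proj₂ picked)
    through-c : ∀ j → ∃ λ u → 0 < δ (emb (Fs (copy j)) u) c
    through-c j = sum>0⇒∃ (λ u → δ (emb (Fs (copy j)) u) c) (proj₂ (proj₂ picked) j)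
    hub : Fin s → Fin m
    hub j = proj₁ (through-c j)
    hub↦c : ∀ j → emb (Fs (copy j)) (hub j) ≡ c
    hub↦c j = δ>0⇒≡ (proj₂ (through-c j))
    spoke : Fin s → Fin m
    spoke j = proj₁ (noIsolated (hub j))
    hub~spoke : ∀ j → adj F (hub j) (spoke j) ≡ true
    hub~spoke j = proj₂ (noIsolated (hub j))
    leaf : Fin s → Fin n
    leaf j = emb (Fs (copy j)) (spoke j)
    edge∈copy : ∀ j → InCopy (Fs (copy j)) c (leaf j)
    edge∈copy j = hub j , spoke j , hub~spoke j , hub↦c j , refl
    edge-owner : ∀ i j → InCopy (Fs i) c (leaf j) → i ≡ copy j
    edge-owner i j c-leaf∈i with i ≟ᶠ copy j
    ... | yes i≡ = i≡
    ... | no  i≢ = ⊥-elim (disjoint i (copy j) i≢ c (leaf j) (c-leaf∈i , edge∈copy j))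
    leaf-inj : Injective _≡_ _≡_ leaf
    leaf-inj {j} {j′} eq = copy-inj (edge-owner (copy j) j′ (subst (InCopy (Fs (copy j)) c) eq (edge∈copy j)))
    leaf≢c : ∀ j → ¬ leaf j ≡ c
    leaf≢c j eq = adj⇒≢ F (hub~spoke j) (inj (Fs (copy j)) (trans (hub↦c j) (sym eq)))
    covered : ∀ j → ∃ λ i → InCopy (Fs i) c (leaf j)
    covered j = copy j , edge∈copy j
    rainbow : ∀ i j j′ → ¬ j ≡ j′ → ¬ (InCopy (Fs i) c (leaf j) × InCopy (Fs i) c (leaf j′))
    rainbow i j j′ j≢j′ (∈j , ∈j′) = j≢j′ (copy-inj (trans (sym (edge-owner i j ∈j)) (edge-owner i j′ ∈j′)))

  degree≤ : NoIsolated F → EdgeDisjoint Fs → ∀ {r} → ¬ RainbowStar (suc r) Fs → ∀ c → degree c ≤ r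
  degree≤ noIsolated disjoint {r} noStar c with degree c ≤? r
  ... | yes deg≤r = deg≤r
  ... | no  deg≰r = contradiction (degree⇒rainbowStar noIsolated disjoint c (≰⇒> deg≰r)) noStar

good⇒k*m≤n*r : ∀ {m} {F : Graph m} → NoIsolated F → ∀ {n r k} → Good F n (suc r) k → k * m ≤ n * r
good⇒k*m≤n*r {m} noIsolated {n} {r} {k} (Fs , disjoint , noStar) = begin
  k * m              ≡⟨ sum-degree ⟨
  sum degree         ≤⟨ sum-mono-≤ (degree≤ noIsolated disjoint noStar) ⟩
  sum {n} (λ _ → r)  ≡⟨ sum-const n r ⟩
  n * r              ∎
  where
  open Degree Fs
  open ≤-Reasoning

good⇒k≤n*r/m : ∀ {m} .{{_ : NonZero m}} {F : Graph m} → NoIsolated F → ∀ {n r k} → Good F n (suc r) k → k ≤ n * r / m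
good⇒k≤n*r/m {m} noIsolated {n} {r} {k} good =
  subst (_≤ n * r / m) (m*n/n≡m k m) (/-monoˡ-≤ m (good⇒k*m≤n*r noIsolated good))

module _ {m n k} {F : Graph m} (Fs : Fin k → Copy F n) where

  sharedEdge⇒≡⇒EdgeDisjoint :
    (∀ i j {u v u′ v′} → ¬ u ≡ v → emb (Fs i) u ≡ emb (Fs j) u′ → emb (Fs i) v ≡ emb (Fs j) v′ → i ≡ j) →
    EdgeDisjoint Fs
  sharedEdge⇒≡⇒EdgeDisjoint shared⇒≡ i j i≢j a b ((u , v , u~v , u↦a , v↦b) , (u′ , v′ , _ , u′↦a , v′↦b)) =
    i≢j (shared⇒≡ i j (adj⇒≢ F u~v) (trans u↦a (sym u′↦a)) (trans v↦b (sym v′↦b)))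

  colouring⇒¬RainbowStar : ∀ {r} (colour : Fin k → Fin m → Fin r) →
    (∀ i j {u u′} → emb (Fs i) u ≡ emb (Fs j) u′ → colour i u ≡ colour j u′ → i ≡ j) →
    ¬ RainbowStar (suc r) Fs
  colouring⇒¬RainbowStar {r} colour sameColour⇒≡ (c , leaf , _ , _ , covered , rainbow) =
    contradiction (injective⇒≤ κ-inj) (1+n≰n {r})
    where
    owner : Fin (suc r) → Fin k
    owner j = proj₁ (covered j)
    hub : Fin (suc r) → Fin m
    hub j = proj₁ (proj₂ (covered j))
    hub↦c : ∀ j → emb (Fs (owner j)) (hub j) ≡ c
    hub↦c j = let _ , _ , _ , _ , u↦c , _ = covered j in u↦c
    κ : Fin (suc r) → Fin r
    κ j = colour (owner j) (hub j)
    κ-inj : Injective _≡_ _≡_ κ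
    κ-inj {j} {j′} κ≡ with j ≟ᶠ j′
    ... | yes j≡j′ = j≡j′
    ... | no  j≢j′ = ⊥-elim (rainbow (owner j) j j′ j≢j′ (proj₂ (covered j) ,
            subst (λ i → InCopy (Fs i) c (leaf j′)) (sym same-owner) (proj₂ (covered j′))))
      where
      same-owner : owner j ≡ owner j′
      same-owner = sameColour⇒≡ (owner j) (owner j′) (trans (hub↦c j) (sym (hub↦c j′))) κ≡

module _ {q x} .{{_ : NonZero q}} (x<q : x < q) where

  [x+A*q]%q≡x : ∀ A → (x + A * q) % q ≡ x
  [x+A*q]%q≡x A = trans ([m+kn]%n≡m%n x A q) (m<n⇒m%n≡m x<q)

  [x+A*q]/q≡A : ∀ A → (x + A * q) / q ≡ A
  [x+A*q]/q≡A A = begin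
    (x + A * q) / q    ≡⟨ +-distrib-/-∣ʳ x (divides-refl A) ⟩
    x / q + A * q / q  ≡⟨ cong₂ _+_ (m<n⇒m/n≡0 x<q) (m*n/n≡m A q) ⟩
    A                  ∎
    where open ≡-Reasoning

divMod-unique : ∀ {q x y} A B → x < q → y < q → x + A * q ≡ y + B * q → x ≡ y × A ≡ B
divMod-unique {q} {x} {y} A B x<q y<q eq = remainders , quotients
  where
  instance _ = >-nonZero (m<n⇒0<n x<q)
  remainders = trans (sym ([x+A*q]%q≡x x<q A)) (trans (cong (_% q) eq) ([x+A*q]%q≡x y<q B))
  quotients = trans (sym ([x+A*q]/q≡A x<q A)) (trans (cong (_/ q) eq) ([x+A*q]/q≡A y<q B))

/-%-injective : ∀ {d} .{{_ : NonZero d}} {x y} → x / d ≡ y / d → x % d ≡ y % d → x ≡ y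
/-%-injective {d} {x} {y} quotients remainders = begin
  x                  ≡⟨ m≡m%n+[m/n]*n x d ⟩
  x % d + x / d * d  ≡⟨ cong₂ (λ r q → r + q * d) remainders quotients ⟩
  y % d + y / d * d  ≡⟨ m≡m%n+[m/n]*n y d ⟨
  y                  ∎
  where open ≡-Reasoning

infix 4 _≡_[mod_]
_≡_[mod_] : ℕ → ℕ → ℕ → Set
x ≡ y [mod q ] = ∃₂ λ A B → x + A * q ≡ y + B * q

module _ {q : ℕ} where

  %≡%⇒≡[mod] : ∀ .{{_ : NonZero q}} {x y} → x % q ≡ y % q → x ≡ y [mod q ]
  %≡%⇒≡[mod] {x} {y} x%q≡y%q = y / q , x / q , (begin
    x + y / q * q                  ≡⟨ cong (_+ y / q * q) (m≡m%n+[m/n]*n x q) ⟩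
    x % q + x / q * q + y / q * q  ≡⟨ cong (λ z → z + x / q * q + y / q * q) x%q≡y%q ⟩
    y % q + x / q * q + y / q * q  ≡⟨ xy∙z≈xz∙y (y % q) (x / q * q) (y / q * q) ⟩
    y % q + y / q * q + x / q * q  ≡⟨ cong (_+ x / q * q) (m≡m%n+[m/n]*n y q) ⟨
    y + x / q * q                  ∎)
    where open ≡-Reasoning

  ≡[mod]-sym : ∀ {x y} → x ≡ y [mod q ] → y ≡ x [mod q ]
  ≡[mod]-sym (A , B , eq) = B , A , sym eq

  ≡[mod]-trans : ∀ {x y z} → x ≡ y [mod q ] → y ≡ z [mod q ] → x ≡ z [mod q ]
  ≡[mod]-trans {x} {y} {z} (A , B , x≡y) (C , D , y≡z) = A + C , B + D , (begin
    x + (A + C) * q      ≡⟨ regroup x A C ⟩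
    (x + A * q) + C * q  ≡⟨ cong (_+ C * q) x≡y ⟩
    (y + B * q) + C * q  ≡⟨ xy∙z≈xz∙y y (B * q) (C * q) ⟩
    (y + C * q) + B * q  ≡⟨ cong (_+ B * q) y≡z ⟩
    (z + D * q) + B * q  ≡⟨ xy∙z≈xz∙y z (D * q) (B * q) ⟩
    (z + B * q) + D * q  ≡⟨ regroup z B D ⟨
    z + (B + D) * q      ∎)
    where
    open ≡-Reasoning
    regroup : ∀ x A C → x + (A + C) * q ≡ (x + A * q) + C * q
    regroup x A C = trans (cong (x +_) (*-distribʳ-+ q A C)) (sym (+-assoc x (A * q) (C * q)))

  ≡[mod]-+ʳ : ∀ {x y} z → x ≡ y [mod q ] → x + z ≡ y + z [mod q ]
  ≡[mod]-+ʳ {x} {y} z (A , B , eq) = A , B , (begin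
    x + z + A * q  ≡⟨ xy∙z≈xz∙y x z (A * q) ⟩
    x + A * q + z  ≡⟨ cong (_+ z) eq ⟩
    y + B * q + z  ≡⟨ xy∙z≈xz∙y y (B * q) z ⟩
    y + z + B * q  ∎)
    where open ≡-Reasoning

  ≡[mod]-cancelˡ : ∀ z {x y} → z + x ≡ z + y [mod q ] → x ≡ y [mod q ]
  ≡[mod]-cancelˡ z {x} {y} (A , B , eq) =
    A , B , +-cancelˡ-≡ z _ _ (trans (sym (+-assoc z x (A * q))) (trans eq (+-assoc z y (B * q))))

  ≡[mod]-cancelʳ : ∀ z {x y} → x + z ≡ y + z [mod q ] → x ≡ y [mod q ]
  ≡[mod]-cancelʳ z {x} {y} = ≡[mod]-cancelˡ z ∘ subst₂ (_≡_[mod q ]) (+-comm x z) (+-comm y z)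

  <⇒≡[mod]⇒≡ : ∀ {x y} → x < q → y < q → x ≡ y [mod q ] → x ≡ y
  <⇒≡[mod]⇒≡ x<q y<q (A , B , eq) = proj₁ (divMod-unique A B x<q y<q eq)

  ≡[mod]-slope : ∀ {a a′ b b′} u d → a + b * u ≡ a′ + b′ * u [mod q ] →
    a + b * (u + d) ≡ a′ + b′ * (u + d) [mod q ] → b * d ≡ b′ * d [mod q ]
  ≡[mod]-slope {a} {a′} {b} {b′} u d at-u at-u+d = ≡[mod]-cancelˡ (a′ + b′ * u)
    (≡[mod]-trans (≡[mod]-sym (≡[mod]-+ʳ (b * d) at-u)) (subst₂ (_≡_[mod q ]) (expand a b) (expand a′ b′) at-u+d))
    where
    expand : ∀ a b → a + b * (u + d) ≡ a + b * u + b * d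
    expand a b = trans (cong (a +_) (*-distribˡ-+ b u d)) (sym (+-assoc a (b * u) (b * d)))

lines-agreeing-twice : ∀ {q r m a a′ b b′ u₁ u₂} → r * m ≤ q → b < r → b′ < r → u₁ < m → u₂ < m → ¬ u₁ ≡ u₂ →
  a + b * u₁ ≡ a′ + b′ * u₁ [mod q ] → a + b * u₂ ≡ a′ + b′ * u₂ [mod q ] → b ≡ b′ × (a ≡ a′ [mod q ])
lines-agreeing-twice {q} {r} {m} {a} {a′} {b} {b′} {u₁} {u₂} rm≤q b<r b′<r u₁<m u₂<m u₁≢u₂ at-u₁ at-u₂
  = slopes-agree , ≡[mod]-cancelʳ (b * u₁) (subst (λ c → a + b * u₁ ≡ a′ + c * u₁ [mod q ]) (sym slopes-agree) at-u₁)
  where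
  slopes-agree-< : ∀ {u v} → u < v → v < m → a + b * u ≡ a′ + b′ * u [mod q ] → a + b * v ≡ a′ + b′ * v [mod q ] → b ≡ b′
  -- b·d and b′·d are both below r·m ≤ q, so their congruence is an equality.
  slopes-agree-< {u} {v} u<v v<m at-u at-v = *-cancelʳ-≡ b b′ d {{>-nonZero (m<n⇒0<n∸m u<v)}}
    (<⇒≡[mod]⇒≡ (scaled<q b<r) (scaled<q b′<r)
      (≡[mod]-slope {a = a} {a′} {b} {b′} u d at-u (subst (λ w → a + b * w ≡ a′ + b′ * w [mod q ]) (sym (m+[n∸m]≡n (<⇒≤ u<v))) at-v)))
    where
    d = v ∸ u
    scaled<q : ∀ {c} → c < r → c * d < q
    scaled<q c<r = <-≤-trans (*-mono-< c<r (≤-<-trans (m∸n≤m v u) v<m)) rm≤q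
  slopes-agree : b ≡ b′
  slopes-agree with <-cmp u₁ u₂
  ... | tri< u₁<u₂ _ _ = slopes-agree-< u₁<u₂ u₂<m at-u₁ at-u₂
  ... | tri≈ _ u₁≡u₂ _ = contradiction u₁≡u₂ u₁≢u₂
  ... | tri> _ _ u₂<u₁ = slopes-agree-< u₂<u₁ u₁<m at-u₂ at-u₁

module Construction (h q ρ r : ℕ) .{{_ : NonZero q}} .{{_ : NonZero r}} (ρ<m : ρ < suc h) (rm≤q : r * suc h ≤ q) where

  m E R G K n : ℕ
  m = suc h
  E = ρ * r / m
  R = E * h
  G = q * r ∸ R
  K = G + E * m
  n = ρ + m * q

  E<r : E < r
  E<r = m<n*o⇒m/o<n (subst (ρ * r <_) (*-comm m r) (*-monoˡ-< r ρ<m))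

  R≤q : R ≤ q
  R≤q = ≤-trans (*-mono-≤ (<⇒≤ E<r) (n≤1+n h)) rm≤q

  R≤q*r : R ≤ q * r
  R≤q*r = ≤-trans R≤q (m≤m*n q r)

  data Point : Set where
    cell  : ℕ → ℕ → Point
    extra : ℕ → Point

  ValidPoint : Point → Set
  ValidPoint (cell i y) = i < m × y < q
  ValidPoint (extra e)  = e < ρ

  cell-injective : ∀ {i y i′ y′} → cell i y ≡ cell i′ y′ → i ≡ i′ × y ≡ y′
  cell-injective refl = refl , refl

  extra-injective : ∀ {e e′} → extra e ≡ extra e′ → e ≡ e′
  extra-injective refl = refl

  index : Point → ℕ
  index (cell i y) = y + i * q
  index (extra e)  = e + m * q

  cell-index< : ∀ {i y} → ValidPoint (cell i y) → ∀ e → index (cell i y) < e + m * q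
  cell-index< {i} {y} (i<m , y<q) e =
    ≤-trans (+-monoˡ-< (i * q) y<q) (≤-trans (*-monoˡ-≤ q i<m) (m≤n+m (m * q) e))

  index<n : ∀ {P} → ValidPoint P → index P < n
  index<n {cell i y} valid = cell-index< valid ρ
  index<n {extra e}  e<ρ   = +-monoˡ-< (m * q) e<ρ

  index-injective : ∀ {P P′} → ValidPoint P → ValidPoint P′ → index P ≡ index P′ → P ≡ P′
  index-injective {cell i y} {cell i′ y′} (_ , y<q) (_ , y′<q) eq with divMod-unique i i′ y<q y′<q eq
  ... | refl , refl = refl
  index-injective {cell i y} {extra e} valid _ eq = contradiction eq (<⇒≢ (cell-index< valid e))
  index-injective {extra e} {cell i y} _ valid eq = contradiction (sym eq) (<⇒≢ (cell-index< valid e))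
  index-injective {extra e} {extra e′} _ _ eq = cong extra (+-cancelʳ-≡ (m * q) e e′ eq)

  data Block : Set where
    line  : ℕ → ℕ → Block
    patch : ℕ → Block

  line-injective : ∀ {b a b′ a′} → line b a ≡ line b′ a′ → b ≡ b′ × a ≡ a′
  line-injective refl = refl , refl

  patch-injective : ∀ {w w′} → patch w ≡ patch w′ → w ≡ w′
  patch-injective refl = refl

  ValidBlock : Block → Set
  ValidBlock (line b a) = b < r × a < q × (b ≡ 0 → R ≤ a)
  ValidBlock (patch w)  = w < E * m

  vertex : Block → ℕ → Point
  vertex (line b a) u       = cell u ((a + b * u) % q)
  vertex (patch w)  zero    = extra (w / r)
  vertex (patch w)  (suc j) = cell (w % m) (w / m * h + j)

  patch-column<R : ∀ {w j} → w < E * m → j < h → w / m * h + j < R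
  patch-column<R {w} {j} w<Em j<h = begin-strict
    w / m * h + j    <⟨ +-monoʳ-< (w / m * h) j<h ⟩
    w / m * h + h    ≡⟨ +-comm (w / m * h) h ⟩
    suc (w / m) * h  ≤⟨ *-monoˡ-≤ h (m<n*o⇒m/o<n {w} {E} {m} w<Em) ⟩
    R                ∎
    where open ≤-Reasoning

  vertex-valid : ∀ {B u} → ValidBlock B → u < m → ValidPoint (vertex B u)
  vertex-valid {line b a} {u}     _    u<m       = u<m , m%n<n (a + b * u) q
  vertex-valid {patch w} {zero}   w<Em _         = m<n*o⇒m/o<n (≤-trans w<Em (m/n*n≤m (ρ * r) m))
  vertex-valid {patch w} {suc j}  w<Em (s≤s j<h) = m%n<n w m , ≤-trans (patch-column<R w<Em j<h) R≤q

  vertex-injective : ∀ B {u v} → vertex B u ≡ vertex B v → u ≡ v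
  vertex-injective (line b a)                 eq = proj₁ (cell-injective eq)
  vertex-injective (patch w) {zero}  {zero}   eq = refl
  vertex-injective (patch w) {suc j} {suc j′} eq = cong suc (+-cancelˡ-≡ (w / m * h) j j′ (proj₂ (cell-injective eq)))

  patch-cell-injective : ∀ {w w′ j j′} → j < h → j′ < h → vertex (patch w) (suc j) ≡ vertex (patch w′) (suc j′) → w ≡ w′
  patch-cell-injective {w} {w′} {j} {j′} j<h j′<h eq with cell-injective eq
  ... | rows , columns with divMod-unique (w / m) (w′ / m) j<h j′<h (trans (+-comm j _) (trans columns (+-comm _ j′)))
  ... | _ , quotients = /-%-injective quotients rows

  patch-cell-row : ∀ {w v i y} → vertex (patch w) v ≡ cell i y → i ≡ w % m
  patch-cell-row {v = suc j} refl = refl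

  line-meets-patch-once : ∀ {b a w u u′ v v′} →
    vertex (line b a) u ≡ vertex (patch w) v → vertex (line b a) u′ ≡ vertex (patch w) v′ → u ≡ u′
  line-meets-patch-once eq eq′ = trans (patch-cell-row (sym eq)) (sym (patch-cell-row (sym eq′)))

  patch-meets-patch-at-cell : ∀ {w w′ j v′} → j < h → v′ < m → vertex (patch w) (suc j) ≡ vertex (patch w′) v′ → w ≡ w′
  patch-meets-patch-at-cell {v′ = suc j′} j<h (s≤s j′<h) eq = patch-cell-injective j<h j′<h eq

  sharedEdge⇒≡ : ∀ {B B′ u v u′ v′} → ValidBlock B → ValidBlock B′ → u < m → v < m → u′ < m → v′ < m → ¬ u ≡ v →
    vertex B u ≡ vertex B′ u′ → vertex B v ≡ vertex B′ v′ → B ≡ B′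
  sharedEdge⇒≡ {line b a} {line b′ a′} (b<r , a<q , _) (b′<r , a′<q , _) u<m v<m _ _ u≢v eu ev
    with cell-injective eu | cell-injective ev
  ... | refl , columns-u | refl , columns-v
    with lines-agreeing-twice rm≤q b<r b′<r u<m v<m u≢v (%≡%⇒≡[mod] columns-u) (%≡%⇒≡[mod] columns-v)
  ... | refl , a≡a′ = cong (line b) (<⇒≡[mod]⇒≡ a<q a′<q a≡a′)
  sharedEdge⇒≡ {line b a} {patch w} _ _ _ _ _ _ u≢v eu ev = contradiction (line-meets-patch-once {b} {a} eu ev) u≢v
  sharedEdge⇒≡ {patch w} {line b a} _ _ _ _ _ _ u≢v eu ev =
    contradiction (vertex-injective (patch w) (trans eu (trans (cong (vertex (line b a)) u′≡v′) (sym ev)))) u≢v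
    where u′≡v′ = line-meets-patch-once {b} {a} (sym eu) (sym ev)
  sharedEdge⇒≡ {patch w} {patch w′} {suc j}         _ _ (s≤s j<h) _ u′<m _ _ eu _ =
    cong patch (patch-meets-patch-at-cell j<h u′<m eu)
  sharedEdge⇒≡ {patch w} {patch w′} {zero} {suc j} _ _ _ (s≤s j<h) _ v′<m _ _ ev =
    cong patch (patch-meets-patch-at-cell j<h v′<m ev)
  sharedEdge⇒≡ {patch w} {patch w′} {zero} {zero}  _ _ _ _ _ _ u≢v _ _ = contradiction refl u≢v

  colour : Block → ℕ → ℕ
  colour (line b a) _       = b
  colour (patch w)  zero    = w % r
  colour (patch w)  (suc _) = 0

  colour<r : ∀ {B u} → ValidBlock B → colour B u < r
  colour<r {line b a}        (b<r , _) = b<r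
  colour<r {patch w} {zero}  _         = m%n<n w r
  colour<r {patch w} {suc _} _         = >-nonZero⁻¹ r

  horizontal-line-avoids-patches : ∀ {a w u j} → ValidBlock (line 0 a) → ValidBlock (patch w) → j < h →
    ¬ vertex (line 0 a) u ≡ vertex (patch w) (suc j)
  horizontal-line-avoids-patches {a} (_ , a<q , R≤a) w<Em j<h eq = <⇒≱ (patch-column<R w<Em j<h) (begin
    R            ≤⟨ R≤a refl ⟩
    a            ≡⟨ m<n⇒m%n≡m a<q ⟨
    a % q        ≡⟨ cong (_% q) (+-identityʳ a) ⟨
    (a + 0) % q  ≡⟨ proj₂ (cell-injective eq) ⟩
    _            ∎)
    where open ≤-Reasoning

  line-patch-colour : ∀ {b a w u v} → ValidBlock (line b a) → ValidBlock (patch w) → v < m →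
    vertex (line b a) u ≡ vertex (patch w) v → ¬ colour (line b a) u ≡ colour (patch w) v
  line-patch-colour {v = suc j} valid w<Em (s≤s j<h) eq refl = horizontal-line-avoids-patches valid w<Em j<h eq

  sameColour⇒≡ : ∀ {B B′ u u′} → ValidBlock B → ValidBlock B′ → u < m → u′ < m →
    vertex B u ≡ vertex B′ u′ → colour B u ≡ colour B′ u′ → B ≡ B′
  sameColour⇒≡ {line b a} {line b a′} {u} (_ , a<q , _) (_ , a′<q , _) _ _ eq refl with cell-injective eq
  ... | refl , columns = cong (line b) (<⇒≡[mod]⇒≡ a<q a′<q (≡[mod]-cancelʳ (b * u) (%≡%⇒≡[mod] columns)))
  sameColour⇒≡ {line b a} {patch w} valid valid′ _ u′<m eq same =
    contradiction same (line-patch-colour valid valid′ u′<m eq)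
  sameColour⇒≡ {patch w} {line b a} valid valid′ u<m _ eq same =
    contradiction (sym same) (line-patch-colour valid′ valid u<m (sym eq))
  sameColour⇒≡ {patch w} {patch w′} {zero}  {zero}   _ _ _ _ eq same =
    cong patch (/-%-injective (extra-injective eq) same)
  sameColour⇒≡ {patch w} {patch w′} {suc j} {suc j′} _ _ (s≤s j<h) (s≤s j′<h) eq _ =
    cong patch (patch-cell-injective j<h j′<h eq)

  -- For t < G, t + R = a + b·q runs through the lines other than the R deleted horizontal ones.
  block : ℕ → Block
  block t with t <? G
  ... | yes _ = line ((t + R) / q) ((t + R) % q)
  ... | no  _ = patch (t ∸ G)

  block-valid : ∀ {t} → t < K → ValidBlock (block t)
  block-valid {t} t<K with t <? G
  ... | yes t<G = slope<r , m%n<n (t + R) q , horizontal⇒R≤a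
    where
    t+R<r*q : t + R < r * q
    t+R<r*q = subst (t + R <_) (trans (m∸n+n≡m R≤q*r) (*-comm q r)) (+-monoˡ-< R t<G)
    slope<r : (t + R) / q < r
    slope<r = m<n*o⇒m/o<n t+R<r*q
    horizontal⇒R≤a : (t + R) / q ≡ 0 → R ≤ (t + R) % q
    horizontal⇒R≤a b≡0 = subst (R ≤_) (begin
      t + R                            ≡⟨ m≡m%n+[m/n]*n (t + R) q ⟩
      (t + R) % q + (t + R) / q * q    ≡⟨ cong (λ b → (t + R) % q + b * q) b≡0 ⟩
      (t + R) % q + 0                  ≡⟨ +-identityʳ _ ⟩
      (t + R) % q                      ∎) (m≤n+m R t)
      where open ≡-Reasoning
  ... | no  t≮G = +-cancelˡ-< G (t ∸ G) (E * m) (subst (_< K) (sym (m+[n∸m]≡n (≮⇒≥ t≮G))) t<K)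

  block-injective : ∀ {t t′} → block t ≡ block t′ → t ≡ t′
  block-injective {t} {t′} eq with t <? G | t′ <? G
  ... | yes _   | yes _    = let slopes , intercepts = line-injective eq
                             in  +-cancelʳ-≡ R t t′ (/-%-injective slopes intercepts)
  ... | no t≮G | no t′≮G = ∸-cancelʳ-≡ (≮⇒≥ t≮G) (≮⇒≥ t′≮G) (patch-injective eq)

  K≡n*r/m : K ≡ n * r / m
  K≡n*r/m = begin
    (q * r ∸ R) + E * m        ≡⟨ cong ((q * r ∸ R) +_) (*-suc E h) ⟩
    (q * r ∸ R) + (E + R)      ≡⟨ x∙yz≈y∙xz (q * r ∸ R) E R ⟩
    E + ((q * r ∸ R) + R)      ≡⟨ cong (E +_) (m∸n+n≡m R≤q*r) ⟩
    E + q * r                  ≡⟨ cong (E +_) (m*n/n≡m (q * r) m) ⟨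
    ρ * r / m + q * r * m / m  ≡⟨ +-distrib-/-∣ʳ (ρ * r) (divides-refl (q * r)) ⟨
    (ρ * r + q * r * m) / m    ≡⟨ cong (_/ m) (expand ρ m q r) ⟨
    n * r / m                  ∎
    where
    open ≡-Reasoning
    expand : ∀ ρ m q r → (ρ + m * q) * r ≡ ρ * r + q * r * m
    expand = solve-∀

  module _ {F : Graph m} where

    blockOf : Fin K → Block
    blockOf t = block (toℕ t)

    blockOf-valid : ∀ t → ValidBlock (blockOf t)
    blockOf-valid t = block-valid (toℕ<n t)

    blockOf-injective : ∀ {t t′} → blockOf t ≡ blockOf t′ → t ≡ t′
    blockOf-injective = toℕ-injective ∘ block-injective

    position : ∀ {P} → ValidPoint P → Fin n
    position valid = fromℕ< (index<n valid)

    position-injective : ∀ {P P′} (valid : ValidPoint P) (valid′ : ValidPoint P′) → position valid ≡ position valid′ → P ≡ P′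
    position-injective valid valid′ = index-injective valid valid′ ∘ fromℕ<-injective _ _ (index<n valid) (index<n valid′)

    place : Fin K → Fin m → Fin n
    place t u = position (vertex-valid (blockOf-valid t) (toℕ<n u))

    place≡⇒vertex≡ : ∀ {t t′ u u′} → place t u ≡ place t′ u′ → vertex (blockOf t) (toℕ u) ≡ vertex (blockOf t′) (toℕ u′)
    place≡⇒vertex≡ {t} {t′} {u} {u′} =
      position-injective (vertex-valid (blockOf-valid t) (toℕ<n u)) (vertex-valid (blockOf-valid t′) (toℕ<n u′))

    copies : Fin K → Copy F n
    copies t = record { emb = place t ; inj = toℕ-injective ∘ vertex-injective (blockOf t) ∘ place≡⇒vertex≡ }

    colouring : Fin K → Fin m → Fin r
    colouring t u = fromℕ< (colour<r {blockOf t} {toℕ u} (blockOf-valid t))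

    good : Good F n (suc r) K
    good = copies
      , sharedEdge⇒≡⇒EdgeDisjoint copies (λ i j {u} {v} {u′} {v′} u≢v eu ev → blockOf-injective
          (sharedEdge⇒≡ (blockOf-valid i) (blockOf-valid j) (toℕ<n u) (toℕ<n v) (toℕ<n u′) (toℕ<n v′)
            (u≢v ∘ toℕ-injective) (place≡⇒vertex≡ eu) (place≡⇒vertex≡ ev)))
      , colouring⇒¬RainbowStar copies colouring (λ i j {u} {u′} eq same → blockOf-injective
          (sameColour⇒≡ (blockOf-valid i) (blockOf-valid j) (toℕ<n u) (toℕ<n u′)
            (place≡⇒vertex≡ eq) (fromℕ<-injective _ _ _ _ same)))

good-empty : ∀ {m n r} {F : Graph m} → Good F n (suc r) 0
good-empty = (λ ()) , (λ ()) , λ (_ , _ , _ , _ , covered , _) → case proj₁ (covered zero) of λ ()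

good-for-large-n : ∀ {m} .{{_ : NonZero m}} (F : Graph m) {r} .{{_ : NonZero r}} {n} → r * m * m ≤ n →
  Good F n (suc r) (n * r / m)
good-for-large-n {suc h} F {r} {n} rmm≤n =
  subst (λ n′ → Good F n′ (suc r) (n′ * r / m)) (sym n≡ρ+m*q) (subst (Good F _ (suc r)) K≡n*r/m good)
  where
  m = suc h
  q = n / m
  ρ = n % m
  rm≤q : r * m ≤ q
  rm≤q = subst (_≤ q) (m*n/n≡m (r * m) m) (/-monoˡ-≤ m rmm≤n)
  instance
    q≢0 : NonZero q
    q≢0 = >-nonZero (≤-trans (>-nonZero⁻¹ (r * m) {{m*n≢0 r m}}) rm≤q)
  n≡ρ+m*q : n ≡ ρ + m * q
  n≡ρ+m*q = trans (m≡m%n+[m/n]*n n m) (cong (ρ +_) (*-comm q m))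
  open Construction h q ρ r (m%n<n n m) rm≤q using (K≡n*r/m; good)

proposition3 : (m : ℕ) .{{_ : NonZero m}} (F : Graph m) → HasEdge F → NoIsolated F →
    (s : ℕ) → 1 ≤ s →
    ∃ λ N → ∀ n → N ≤ n → IsExF F n s ((n * (s ∸ 1)) / m)
proposition3 m F _ noIsolated (suc zero) _ = 0 , λ n _ →
  subst (Good F n 1) (sym (trans (cong (_/ m) (*-zeroʳ n)) (0/n≡0 m))) good-empty , λ _ → good⇒k≤n*r/m noIsolated
proposition3 m F _ noIsolated (suc r@(suc _)) _ = r * m * m , λ n rmm≤n →
  good-for-large-n F rmm≤n , λ _ → good⇒k≤n*r/m noIsolated
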